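{- The axiom $(p\wedge(p>q))\to q$ is squeeze-persistent: for every conditional Esakia space $\mathbb X$, if all formulas of $\mathsf{iCC}\oplus((p\wedge(p>q))\to q)$ are valid on $\mathbb X$, then all of them are valid on the squeeze fill-in $\kappa_s(\mathbb X)$.
   Context: Formulas: $\phi::=p\mid\bot\mid\phi\wedge\phi\mid\phi\vee\phi\mid\phi\to\phi\mid\phi>\phi$, $\top:=\bot\to\bot$. $\mathsf{ICK}\oplus\Gamma$ is the smallest set of formulas containing the axioms of intuitionistic propositional logic, $\Gamma$, $(p>(q\wedge r))\leftrightarrow((p>q)\wedge(p>r))$ and $(p>\top)\leftrightarrow\top$, closed under uniform substitution, modus ponens and: from $\phi\leftrightarrow\psi$ infer $(\phi>\chi)\leftrightarrow(\psi>\chi)$ and $(\chi>\phi)\leftrightarrow(\chi>\psi)$. $\mathsf{iCC}:=\mathsf{ICK}\oplus(p>p)\oplus(((p>q)\wedge((p\wedge q)>r))\to(p>r))\oplus(((p>q)\wedge(p>r))\to((p\wedge q)>r))$. An Esakia space is $(X,\le,\tau)$ with $(X,\le)$ a nonempty poset, $\tau$ compact, such that if $x\not\le y$ some clopen upset contains $x$ but not $y$, and ${\downarrow}a$ is clopen for clopen $a$. A conditional Esakia space $\mathbb X=(X,\le,\tau,\mathcal R)$ adds relations $\{R_a: a\text{ clopen upset}\}$ with: $\{x:R_a[x]\subseteq b\}$ clopen for clopen upsets $a,b$; $({\le}\circ R_a\circ{\le})=R_a$; each $R_a[x]=\{y:xR_ay\}$ closed. Validity on $\mathbb X$ uses only valuations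 into clopen upsets. A conditional Kripke frame has relations for all upsets with: $x\le yR_az$ implies $xR_aw\le z$ for some $w$; validity uses all upset valuations. Truth: intuitionistic Kripke clauses and $x\models\phi>\psi$ iff every $y$ with $xR_{V(\phi)}y$ satisfies $\psi$. The squeeze fill-in $\kappa_s(\mathbb X)=(X,\le,\mathcal R')$: $R'_a=R_a$ for clopen upsets $a$; for non-clopen upset $c$, $R'_c[x]:=R_a[x]$ if some clopen upset $a$ has $R_a[x]\subseteq c\subseteq a$, else $R'_c[x]:=c$. -}

module Defs where

open import Level using (Level)
open import Data.Nat using (ℕ)
open import Data.Bool using (Bool; T)
open import Data.Empty using (⊥)
open import Data.Unit using (⊤)
open import Data.Product using (Σ; _×_; _,_)
open import Data.Sum using (_⊎_)
open import Data.List using (List)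
open import Data.List.Relation.Unary.Any using (Any)
open import Relation.Nullary using (¬_)
open import Relation.Binary.PropositionalEquality using (_≡_)
open import Relation.Binary.Structures using (IsPartialOrder)

infixr 6 _⋀_
infixr 5 _⋁_
infixr 4 _⇒_
infixr 7 _⊳_
infix 3 _⟺_

data Fm : Set where
  var : ℕ → Fm
  ⊥' : Fm
  _⋀_ _⋁_ _⇒_ _⊳_ : Fm → Fm → Fm

⊤' : Fm
⊤' = ⊥' ⇒ ⊥'

_⟺_ : Fm → Fm → Fm
φ ⟺ ψ = (φ ⇒ ψ) ⋀ (ψ ⇒ φ)

_[_] : Fm → (ℕ → Fm) → Fm
var n [ σ ] = σ n
⊥' [ σ ] = ⊥'
(φ ⋀ ψ) [ σ ] = (φ [ σ ]) ⋀ (ψ [ σ ])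
(φ ⋁ ψ) [ σ ] = (φ [ σ ]) ⋁ (ψ [ σ ])
(φ ⇒ ψ) [ σ ] = (φ [ σ ]) ⇒ (ψ [ σ ])
(φ ⊳ ψ) [ σ ] = (φ [ σ ]) ⊳ (ψ [ σ ])

p q r : Fm
p = var 0
q = var 1
r = var 2

data iCC-MP : Fm → Set where
  ipc1 : iCC-MP (p ⇒ (q ⇒ p))
  ipc2 : iCC-MP ((p ⇒ (q ⇒ r)) ⇒ ((p ⇒ q) ⇒ (p ⇒ r)))
  ipc3 : iCC-MP ((p ⋀ q) ⇒ p)
  ipc4 : iCC-MP ((p ⋀ q) ⇒ q)
  ipc5 : iCC-MP (p ⇒ (q ⇒ (p ⋀ q)))
  ipc6 : iCC-MP (p ⇒ (p ⋁ q))
  ipc7 : iCC-MP (q ⇒ (p ⋁ q))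
  ipc8 : iCC-MP ((p ⇒ r) ⇒ ((q ⇒ r) ⇒ ((p ⋁ q) ⇒ r)))
  ipc9 : iCC-MP (⊥' ⇒ p)
  ck-and : iCC-MP ((p ⊳ (q ⋀ r)) ⟺ ((p ⊳ q) ⋀ (p ⊳ r)))
  ck-top : iCC-MP ((p ⊳ ⊤') ⟺ ⊤')
  cc-id  : iCC-MP (p ⊳ p)
  cc-cut : iCC-MP (((p ⊳ q) ⋀ ((p ⋀ q) ⊳ r)) ⇒ (p ⊳ r))
  cc-cm  : iCC-MP (((p ⊳ q) ⋀ (p ⊳ r)) ⇒ ((p ⋀ q) ⊳ r))
  cc-mp  : iCC-MP ((p ⋀ (p ⊳ q)) ⇒ q)
  usub : ∀ {φ} (σ : ℕ → Fm) → iCC-MP φ → iCC-MP (φ [ σ ])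
  mp   : ∀ {φ ψ} → iCC-MP (φ ⇒ ψ) → iCC-MP φ → iCC-MP ψ
  rcea : ∀ {φ ψ χ} → iCC-MP (φ ⟺ ψ) → iCC-MP ((φ ⊳ χ) ⟺ (ψ ⊳ χ))
  rcec : ∀ {φ ψ χ} → iCC-MP (φ ⟺ ψ) → iCC-MP ((χ ⊳ φ) ⟺ (χ ⊳ ψ))

_⊆_ : {X : Set} → (X → Set) → (X → Set) → Set
a ⊆ b = ∀ x → a x → b x

Upset : {X : Set} → (X → X → Set) → (X → Set) → Set
Upset {X} _≤_ a = ∀ (x y : X) → x ≤ y → a x → a y

sat : {X : Set} (_≤_ : X → X → Set) (R : (X → Set) → X → X → Set)
      (V : ℕ → X → Set) → Fm → X → Set
sat _≤_ R V (var n) x = V n x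
sat _≤_ R V ⊥' x = ⊥
sat _≤_ R V (φ ⋀ ψ) x = sat _≤_ R V φ x × sat _≤_ R V ψ x
sat _≤_ R V (φ ⋁ ψ) x = sat _≤_ R V φ x ⊎ sat _≤_ R V ψ x
sat {X} _≤_ R V (φ ⇒ ψ) x =
  ∀ (y : X) → x ≤ y → sat _≤_ R V φ y → sat _≤_ R V ψ y
sat {X} _≤_ R V (φ ⊳ ψ) x =
  ∀ (y : X) → R (sat _≤_ R V φ) x y → sat _≤_ R V ψ y

record Topology (X : Set) : Set₁ where
  field
    Open     : (X → Set) → Set
    Open-ext : ∀ {a b} → a ⊆ b → b ⊆ a → Open a → Open b
    Open-univ : Open (λ _ → ⊤)
    Open-∩   : ∀ {a b} → Open a → Open b → Open (λ x → a x × b x)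
    Open-⋃   : {I : Set} (U : I → X → Set) → (∀ i → Open (U i)) →
               Open (λ x → Σ I (λ i → U i x))

  Closed : (X → Set) → Set
  Closed a = Open (λ x → ¬ a x)

  Clopen : (X → Set) → Set
  Clopen a = Open a × Closed a

Compact : {X : Set} → Topology X → Set₁
Compact {X} τ = {I : Set} (U : I → X → Set) → (∀ i → Topology.Open τ (U i)) →
  (∀ x → Σ I (λ i → U i x)) →
  Σ (List I) (λ is → ∀ x → Any (λ i → U i x) is)

record EsakiaSpace : Set₁ where
  field
    X    : Set
    _≤_  : X → X → Set
    ≤-po : IsPartialOrder _≡_ _≤_
    point : X                       -- nonempty
    τ    : Topology X
    compact : Compact τ
  open Topology τ public

  ClopenUpset : (X → Set) → Set
  ClopenUpset a = Clopen a × Upset _≤_ a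

  field
    separation : ∀ x y → ¬ (x ≤ y) →
      Σ (X → Set) (λ a → ClopenUpset a × a x × ¬ a y)
    down-clopen : ∀ a → Clopen a → Clopen (λ x → Σ X (λ y → x ≤ y × a y))

record CondEsakiaSpace : Set₁ where
  field
    esakia : EsakiaSpace
  open EsakiaSpace esakia public
  field
    -- R a is meant for clopen upsets a; values at other subsets are irrelevant
    R : (X → Set) → X → X → Set
    -- R is indexed by the *set* a (extensionality)
    R-ext : ∀ a b → ClopenUpset a → ClopenUpset b → a ⊆ b → b ⊆ a →
            ∀ x y → R a x y → R b x y
    R-box-clopen : ∀ a b → ClopenUpset a → ClopenUpset b →
                   Clopen (λ x → ∀ y → R a x y → b y)
    R-≤₁ : ∀ a → ClopenUpset a → ∀ x y →
           Σ X (λ x' → Σ X (λ y' → x ≤ x' × R a x' y' × y' ≤ y)) → R a x y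
    R-≤₂ : ∀ a → ClopenUpset a → ∀ x y →
           R a x y → Σ X (λ x' → Σ X (λ y' → x ≤ x' × R a x' y' × y' ≤ y))
    R-closed : ∀ a → ClopenUpset a → ∀ x → Closed (λ y → R a x y)

ValidE : CondEsakiaSpace → Fm → Set₁
ValidE 𝕏 φ = ∀ (V : ℕ → X → Set) → (∀ n → ClopenUpset (V n)) →
             ∀ x → sat _≤_ R V φ x
  where open CondEsakiaSpace 𝕏

record CondKripkeFrame : Set₁ where
  field
    X   : Set
    _≤_ : X → X → Set
    R   : (X → Set) → X → X → Set

ValidK : CondKripkeFrame → Fm → Set₁
ValidK 𝔽 φ = ∀ (V : ℕ → X → Set) → (∀ n → Upset _≤_ (V n)) →
             ∀ x → sat _≤_ R V φ x
  where open CondKripkeFrame 𝔽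

module _ (𝕏 : CondEsakiaSpace) where
  open CondEsakiaSpace 𝕏

  SqueezeWitness : (X → Set) → (X → Set) → X → Set
  SqueezeWitness a c x = ClopenUpset a × (∀ y → R a x y → c y) × (c ⊆ a)

  Rsq : (X → Set) → X → X → Set
  Rsq c x y =
    Σ (X → Bool) (λ a → SqueezeWitness (λ z → T (a z)) c x × R (λ z → T (a z)) x y)
    ⊎ ((¬ Σ (X → Bool) (λ a → SqueezeWitness (λ z → T (a z)) c x)) × c y)

  R′ : (X → Set) → X → X → Set
  R′ c x y = (ClopenUpset c × R c x y) ⊎ ((¬ ClopenUpset c) × Rsq c x y)

  κs : CondKripkeFrame
  κs = record { X = X ; _≤_ = _≤_ ; R = R′ }

-- Validity of cc-mp forces every R_a to be reflexive on a, once one knows (by compactness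
-- and Priestley separation) that R_a[x] is the intersection of the clopen upsets containing
-- it.  Cut and cautious monotonicity then show that R_a[x] only depends on the interval it
-- squeezes: if R_a[x] ⊆ c ⊆ a and R_b[x] ⊆ c ⊆ b then R_a[x] = R_b[x].  So R′_c[x] is
-- R_a[x] for any squeezing a, or c itself; in either case it lies inside c, contains x when
-- x ∈ c, is antitone in x and validates cut and cautious monotonicity, which is what the
-- axioms need on κ_s(𝕏).  The rules are sound because truth sets are upsets and R′_c
-- depends only on the extension of c.
module Submission where

open import Defs
open import Axiom.ExcludedMiddle using (ExcludedMiddle)
open import Data.Nat using (ℕ; suc)
open import Data.Bool using (Bool; true; false; T; if_then_else_)
open import Data.Empty using (⊥; ⊥-elim)
open import Data.Unit using (⊤; tt)
open import Data.Product using (Σ; _×_; _,_; proj₁; proj₂; swap)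
open import Data.Sum using (_⊎_; inj₁; inj₂; [_,_])
open import Data.List using (List; []; _∷_)
open import Data.List.Relation.Unary.Any as Any using (Any)
open import Relation.Nullary using (¬_; yes; no)
open import Relation.Nullary.Decidable using (isYes; toWitness; fromWitness)
open import Relation.Unary using (∅; ∁; _∪_; _∩_)
open import Relation.Binary.Structures using (IsPartialOrder)

assign : {X : Set} → (X → Set) → (X → Set) → (X → Set) → ℕ → X → Set
assign a b c 0 = a
assign a b c 1 = b
assign a b c (suc (suc _)) = c

assign-all : {X : Set} (P : (X → Set) → Set) {a b c : X → Set} →
             P a → P b → P c → ∀ n → P (assign a b c n)
assign-all P pa pb pc 0 = pa
assign-all P pa pb pc 1 = pb
assign-all P pa pb pc (suc (suc _)) = pc

module KripkeSemantics {X : Set} (_≤_ : X → X → Set) (R : (X → Set) → X → X → Set) where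

  sat-upset : (∀ {x y z} → x ≤ y → y ≤ z → x ≤ z) →
              (∀ {c x y} → x ≤ y → R c y ⊆ R c x) →
              ∀ V → (∀ n → Upset _≤_ (V n)) → ∀ φ → Upset _≤_ (sat _≤_ R V φ)
  sat-upset trans R-antitone V V-up = go
    where
    go : ∀ φ → Upset _≤_ (sat _≤_ R V φ)
    go (var n) = V-up n
    go ⊥' x y x≤y ()
    go (φ ⋀ ψ) x y x≤y (sφ , sψ) = go φ x y x≤y sφ , go ψ x y x≤y sψ
    go (φ ⋁ ψ) x y x≤y (inj₁ sφ) = inj₁ (go φ x y x≤y sφ)
    go (φ ⋁ ψ) x y x≤y (inj₂ sψ) = inj₂ (go ψ x y x≤y sψ)
    go (φ ⇒ ψ) x y x≤y f z y≤z = f z (trans x≤y y≤z)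
    go (φ ⊳ ψ) x y x≤y f z r = f z (R-antitone x≤y z r)

  module _ (R-ext : ∀ {a b} → a ⊆ b → b ⊆ a → ∀ x → R a x ⊆ R b x)
           (V : ℕ → X → Set) (σ : ℕ → Fm) where

    private
      V[σ] : ℕ → X → Set
      V[σ] n = sat _≤_ R V (σ n)

    sat-[]⁺ : ∀ φ → sat _≤_ R V[σ] φ ⊆ sat _≤_ R V (φ [ σ ])
    sat-[]⁻ : ∀ φ → sat _≤_ R V (φ [ σ ]) ⊆ sat _≤_ R V[σ] φ

    sat-[]⁺ (var n) x s = s
    sat-[]⁺ ⊥' x ()
    sat-[]⁺ (φ ⋀ ψ) x (sφ , sψ) = sat-[]⁺ φ x sφ , sat-[]⁺ ψ x sψ
    sat-[]⁺ (φ ⋁ ψ) x (inj₁ sφ) = inj₁ (sat-[]⁺ φ x sφ)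
    sat-[]⁺ (φ ⋁ ψ) x (inj₂ sψ) = inj₂ (sat-[]⁺ ψ x sψ)
    sat-[]⁺ (φ ⇒ ψ) x f y x≤y sφ = sat-[]⁺ ψ y (f y x≤y (sat-[]⁻ φ y sφ))
    sat-[]⁺ (φ ⊳ ψ) x f y r = sat-[]⁺ ψ y (f y (R-ext (sat-[]⁻ φ) (sat-[]⁺ φ) x y r))

    sat-[]⁻ (var n) x s = s
    sat-[]⁻ ⊥' x ()
    sat-[]⁻ (φ ⋀ ψ) x (sφ , sψ) = sat-[]⁻ φ x sφ , sat-[]⁻ ψ x sψ
    sat-[]⁻ (φ ⋁ ψ) x (inj₁ sφ) = inj₁ (sat-[]⁻ φ x sφ)
    sat-[]⁻ (φ ⋁ ψ) x (inj₂ sψ) = inj₂ (sat-[]⁻ ψ x sψ)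
    sat-[]⁻ (φ ⇒ ψ) x f y x≤y sφ = sat-[]⁻ ψ y (f y x≤y (sat-[]⁺ φ y sφ))
    sat-[]⁻ (φ ⊳ ψ) x f y r = sat-[]⁻ ψ y (f y (R-ext (sat-[]⁺ φ) (sat-[]⁻ φ) x y r))

module ClopenUpsets (em : ∀ {ℓ} → ExcludedMiddle ℓ) (𝔼 : EsakiaSpace) where
  open EsakiaSpace 𝔼

  clopenUpset-ext : ∀ {a b} → a ⊆ b → b ⊆ a → ClopenUpset a → ClopenUpset b
  clopenUpset-ext a⊆b b⊆a ((open-a , closed-a) , up-a) =
    (Open-ext a⊆b b⊆a open-a ,
     Open-ext (λ x ¬a b → ¬a (b⊆a x b)) (λ x ¬b a → ¬b (a⊆b x a)) closed-a) ,
    (λ x y x≤y bx → a⊆b y (up-a x y x≤y (b⊆a x bx)))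

  open-∪ : ∀ {a b} → Open a → Open b → Open (a ∪ b)
  open-∪ {a} {b} open-a open-b =
    Open-ext (λ { x (true , ax) → inj₁ ax ; x (false , bx) → inj₂ bx })
             (λ { x (inj₁ ax) → true , ax ; x (inj₂ bx) → false , bx })
             (Open-⋃ (λ i → if i then a else b) λ { true → open-a ; false → open-b })

  clopenUpset-∅ : ClopenUpset ∅
  clopenUpset-∅ =
    (Open-ext (λ x s → ⊥-elim (proj₁ s)) (λ x ()) (Open-⋃ {I = ⊥} (λ ()) (λ ())) ,
     Open-ext (λ x _ ()) (λ x _ → tt) Open-univ) ,
    (λ x y _ ())

  clopenUpset-∪ : ∀ {a b} → ClopenUpset a → ClopenUpset b → ClopenUpset (a ∪ b)
  clopenUpset-∪ ((open-a , closed-a) , up-a) ((open-b , closed-b) , up-b) =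
    (open-∪ open-a open-b ,
     Open-ext (λ x (¬a , ¬b) → [ ¬a , ¬b ]) (λ x ¬ab → (λ ax → ¬ab (inj₁ ax)) , (λ bx → ¬ab (inj₂ bx)))
              (Open-∩ closed-a closed-b)) ,
    (λ { x y x≤y (inj₁ ax) → inj₁ (up-a x y x≤y ax) ; x y x≤y (inj₂ bx) → inj₂ (up-b x y x≤y bx) })

  clopenUpset-∩ : ∀ {a b} → ClopenUpset a → ClopenUpset b → ClopenUpset (a ∩ b)
  clopenUpset-∩ {a} {b} ((open-a , closed-a) , up-a) ((open-b , closed-b) , up-b) =
    (Open-∩ open-a open-b ,
     Open-ext (λ x → [ (λ ¬a ab → ¬a (proj₁ ab)) , (λ ¬b ab → ¬b (proj₂ ab)) ]) de-Morgan
              (open-∪ closed-a closed-b)) ,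
    (λ x y x≤y (ax , bx) → up-a x y x≤y ax , up-b x y x≤y bx)
    where
    de-Morgan : ∁ (a ∩ b) ⊆ (∁ a ∪ ∁ b)
    de-Morgan x ¬ab with em {P = a x}
    ... | yes ax = inj₂ (λ bx → ¬ab (ax , bx))
    ... | no ¬a = inj₁ ¬a

  clopenUpset-Any : {I : Set} (D : I → X → Set) → (∀ i → ClopenUpset (D i)) →
                    ∀ is → ClopenUpset (λ y → Any (λ i → D i y) is)
  clopenUpset-Any D cu [] = clopenUpset-ext (λ _ ()) (λ _ ()) clopenUpset-∅
  clopenUpset-Any D cu (i ∷ is) =
    clopenUpset-ext (λ _ → Any.fromSum) (λ _ → Any.toSum)
                    (clopenUpset-∪ (cu i) (clopenUpset-Any D cu is))

  separate-closed : ∀ C z → Closed C → (∀ w → C w → ¬ w ≤ z) →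
                    Σ (X → Set) λ D → ClopenUpset D × C ⊆ D × ¬ D z
  separate-closed C z closed-C w≰z = D , clopenUpset-Any S cu-S is , C⊆D , ¬Dz
    where
    separator : ∀ {w} → C w → Σ (X → Set) λ d → ClopenUpset d × d w × ¬ d z
    separator {w} cw = separation w z (w≰z w cw)

    I : Set
    I = Σ X C ⊎ ⊤

    U S : I → X → Set
    U (inj₁ (_ , cw)) = proj₁ (separator cw)
    U (inj₂ _) = ∁ C
    S (inj₁ (_ , cw)) = proj₁ (separator cw)
    S (inj₂ _) = ∅

    open-U : ∀ i → Open (U i)
    open-U (inj₁ (_ , cw)) = proj₁ (proj₁ (proj₁ (proj₂ (separator cw))))
    open-U (inj₂ _) = closed-C

    cu-S : ∀ i → ClopenUpset (S i)
    cu-S (inj₁ (_ , cw)) = proj₁ (proj₂ (separator cw))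
    cu-S (inj₂ _) = clopenUpset-∅

    cover : ∀ y → Σ I λ i → U i y
    cover y with em {P = C y}
    ... | yes cy = inj₁ (y , cy) , proj₁ (proj₂ (proj₂ (separator cy)))
    ... | no ¬cy = inj₂ tt , ¬cy

    is : List I
    is = proj₁ (compact U open-U cover)

    D : X → Set
    D y = Any (λ i → S i y) is

    C⊆D : C ⊆ D
    C⊆D y cy = Any.map (λ {i} → U⊆S i) (proj₂ (compact U open-U cover) y)
      where
      U⊆S : ∀ i → U i y → S i y
      U⊆S (inj₁ _) u = u
      U⊆S (inj₂ _) ¬cy = ¬cy cy

    ¬Dz : ¬ D z
    ¬Dz dz with Any.satisfied dz
    ... | inj₁ (_ , cw) , dwz = proj₂ (proj₂ (proj₂ (separator cw))) dwz

module ConditionalEsakia (em : ∀ {ℓ} → ExcludedMiddle ℓ) (𝕏 : CondEsakiaSpace) where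
  open CondEsakiaSpace 𝕏
  open ClopenUpsets em esakia
  open IsPartialOrder ≤-po using () renaming (refl to ≤-refl)

  R-antitone : ∀ {a x y} → ClopenUpset a → x ≤ y → R a y ⊆ R a x
  R-antitone {a} {x} {y} cu-a x≤y z r = R-≤₁ a cu-a x z (y , z , x≤y , r , ≤-refl)

  R-from-clopenUpsets : ∀ {a x z} → ClopenUpset a →
                        (∀ d → ClopenUpset d → R a x ⊆ d → d z) → R a x z
  R-from-clopenUpsets {a} {x} {z} cu-a z∈⋂ with em {P = R a x z}
  ... | yes r = r
  ... | no ¬r with separate-closed (R a x) z (R-closed a cu-a x)
                     (λ w r w≤z → ¬r (R-≤₁ a cu-a x z (x , w , ≤-refl , r , w≤z)))
  ...   | D , cu-D , R⊆D , ¬Dz = ⊥-elim (¬Dz (z∈⋂ D cu-D R⊆D))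

  squeezeWitness-mono : ∀ {a c x y} → x ≤ y → SqueezeWitness 𝕏 a c x → SqueezeWitness 𝕏 a c y
  squeezeWitness-mono x≤y (cu-a , Ra⊆c , c⊆a) =
    cu-a , (λ z r → Ra⊆c z (R-antitone cu-a x≤y z r)) , c⊆a

module SqueezeFillIn (em : ∀ {ℓ} → ExcludedMiddle ℓ) (𝕏 : CondEsakiaSpace)
                     (valid : ∀ φ → iCC-MP φ → ValidE 𝕏 φ) where
  open CondEsakiaSpace 𝕏
  open ClopenUpsets em esakia
  open IsPartialOrder ≤-po using () renaming (refl to ≤-refl; trans to ≤-trans)
  open ConditionalEsakia em 𝕏

  R-⊆ : ∀ {a} → ClopenUpset a → ∀ x → R a x ⊆ a
  R-⊆ {a} cu-a = valid (p ⊳ p) cc-id (assign a a a) (assign-all ClopenUpset cu-a cu-a cu-a)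

  module _ {a b d} (cu-a : ClopenUpset a) (cu-b : ClopenUpset b) (cu-d : ClopenUpset d) (x : X) where

    private
      V : ℕ → X → Set
      V = assign a b d
      cu-V : ∀ n → ClopenUpset (V n)
      cu-V = assign-all ClopenUpset cu-a cu-b cu-d

    R-cut : R a x ⊆ b → R (a ∩ b) x ⊆ d → R a x ⊆ d
    R-cut Ra⊆b Rab⊆d = valid _ cc-cut V cu-V x x ≤-refl (Ra⊆b , Rab⊆d)

    R-cautious-mono : R a x ⊆ b → R a x ⊆ d → R (a ∩ b) x ⊆ d
    R-cautious-mono Ra⊆b Ra⊆d = valid _ cc-cm V cu-V x x ≤-refl (Ra⊆b , Ra⊆d)

  -- By cc-mp, x ∈ a lies in every clopen upset containing R_a[x].
  R-refl : ∀ {a x} → ClopenUpset a → a x → R a x x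
  R-refl {a} {x} cu-a ax = R-from-clopenUpsets cu-a λ d cu-d Ra⊆d →
    valid _ cc-mp (assign a d a) (assign-all ClopenUpset cu-a cu-d cu-a) x x ≤-refl (ax , Ra⊆d)

  squeeze-unique : ∀ {a b c x} → SqueezeWitness 𝕏 a c x → SqueezeWitness 𝕏 b c x → R a x ⊆ R b x
  squeeze-unique {a} {b} {c} {x} (cu-a , Ra⊆c , c⊆a) (cu-b , Rb⊆c , c⊆b) z Raz =
    R-from-clopenUpsets cu-b λ d cu-d Rb⊆d → R-cut cu-a cu-b cu-d x Ra⊆b (Rab⊆d cu-d Rb⊆d) z Raz
    where
    Ra⊆b : R a x ⊆ b
    Ra⊆b y r = c⊆b y (Ra⊆c y r)

    Rab⊆d : ∀ {d} → ClopenUpset d → R b x ⊆ d → R (a ∩ b) x ⊆ d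
    Rab⊆d cu-d Rb⊆d y r =
      R-cautious-mono cu-b cu-a cu-d x (λ y r → c⊆a y (Rb⊆c y r)) Rb⊆d y
        (R-ext (a ∩ b) (b ∩ a) (clopenUpset-∩ cu-a cu-b) (clopenUpset-∩ cu-b cu-a)
               (λ _ → swap) (λ _ → swap) x y r)

  ⟦_⟧ : (X → Bool) → X → Set
  ⟦ a ⟧ z = T (a z)

  Squeezable : (X → Set) → X → Set
  Squeezable c x = Σ (X → Bool) λ a → SqueezeWitness 𝕏 ⟦ a ⟧ c x

  -- Squeeze witnesses in R′ are Bool-valued so that R′ stays in Set; excluded middle
  -- gives every predicate such a code.
  clopenUpset-squeezable : ∀ {c} → ClopenUpset c → ∀ x → Squeezable c x
  clopenUpset-squeezable {c} cu-c x = code , cu-code , Rcode⊆c , c⊆code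
    where
    code : X → Bool
    code z = isYes (em {P = c z})
    code⊆c : ⟦ code ⟧ ⊆ c
    code⊆c z = toWitness
    c⊆code : c ⊆ ⟦ code ⟧
    c⊆code z = fromWitness
    cu-code : ClopenUpset ⟦ code ⟧
    cu-code = clopenUpset-ext c⊆code code⊆c cu-c
    Rcode⊆c : R ⟦ code ⟧ x ⊆ c
    Rcode⊆c y r = R-⊆ cu-c x y (R-ext ⟦ code ⟧ c cu-code cu-c code⊆c c⊆code x y r)

  R′-⊆ : ∀ c x → R′ 𝕏 c x ⊆ c
  R′-⊆ c x y (inj₁ (cu-c , r)) = R-⊆ cu-c x y r
  R′-⊆ c x y (inj₂ (_ , inj₁ (_ , (_ , Ra⊆c , _) , r))) = Ra⊆c y r
  R′-⊆ c x y (inj₂ (_ , inj₂ (_ , cy))) = cy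

  R′-ext : ∀ {c c′} → c ⊆ c′ → c′ ⊆ c → ∀ x → R′ 𝕏 c x ⊆ R′ 𝕏 c′ x
  R′-ext {c} {c′} c⊆c′ c′⊆c x y (inj₁ (cu-c , r)) =
    inj₁ (cu-c′ , R-ext c c′ cu-c cu-c′ c⊆c′ c′⊆c x y r)
    where
    cu-c′ : ClopenUpset c′
    cu-c′ = clopenUpset-ext c⊆c′ c′⊆c cu-c
  R′-ext c⊆c′ c′⊆c x y (inj₂ (¬cu-c , r)) =
    inj₂ ((λ cu-c′ → ¬cu-c (clopenUpset-ext c′⊆c c⊆c′ cu-c′)) , Rsq-ext r)
    where
    witness-ext : ∀ {c c′ a} → c ⊆ c′ → c′ ⊆ c → SqueezeWitness 𝕏 a c x → SqueezeWitness 𝕏 a c′ x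
    witness-ext c⊆c′ c′⊆c (cu-a , Ra⊆c , c⊆a) =
      cu-a , (λ z r → c⊆c′ z (Ra⊆c z r)) , (λ z c′z → c⊆a z (c′⊆c z c′z))
    Rsq-ext : Rsq 𝕏 _ x y → Rsq 𝕏 _ x y
    Rsq-ext (inj₁ (a , w , r)) = inj₁ (a , witness-ext c⊆c′ c′⊆c w , r)
    Rsq-ext (inj₂ (¬sq , cy)) =
      inj₂ ((λ (a , w) → ¬sq (a , witness-ext c′⊆c c⊆c′ w)) , c⊆c′ y cy)

  module _ {c x} (a : X → Bool) (w : SqueezeWitness 𝕏 ⟦ a ⟧ c x) where

    R′-⊆-squeeze : R′ 𝕏 c x ⊆ R ⟦ a ⟧ x
    R′-⊆-squeeze y (inj₁ (cu-c , r)) = squeeze-unique (cu-c , R-⊆ cu-c x , λ _ cz → cz) w y r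
    R′-⊆-squeeze y (inj₂ (_ , inj₁ (_ , wb , r))) = squeeze-unique wb w y r
    R′-⊆-squeeze y (inj₂ (_ , inj₂ (¬sq , _))) = ⊥-elim (¬sq (a , w))

    squeeze-⊆-R′ : R ⟦ a ⟧ x ⊆ R′ 𝕏 c x
    squeeze-⊆-R′ y r with em {P = ClopenUpset c}
    ... | yes cu-c = inj₁ (cu-c , squeeze-unique w (cu-c , R-⊆ cu-c x , λ _ cz → cz) y r)
    ... | no ¬cu-c = inj₂ (¬cu-c , inj₁ (a , w , r))

  unsqueezable-⊆-R′ : ∀ {c x} → ¬ Squeezable c x → c ⊆ R′ 𝕏 c x
  unsqueezable-⊆-R′ {c} {x} ¬sq y cy with em {P = ClopenUpset c}
  ... | yes cu-c = ⊥-elim (¬sq (clopenUpset-squeezable cu-c x))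
  ... | no ¬cu-c = inj₂ (¬cu-c , inj₂ (¬sq , cy))

  R′-antitone : ∀ {c x y} → x ≤ y → R′ 𝕏 c y ⊆ R′ 𝕏 c x
  R′-antitone {c} {x} {y} x≤y z r with em {P = Squeezable c x}
  ... | yes (a , w) = squeeze-⊆-R′ a w z
                        (R-antitone (proj₁ w) x≤y z (R′-⊆-squeeze a (squeezeWitness-mono x≤y w) z r))
  ... | no ¬sq = unsqueezable-⊆-R′ ¬sq z (R′-⊆ c y z r)

  R′-refl : ∀ {c x} → c x → R′ 𝕏 c x x
  R′-refl {c} {x} cx with em {P = Squeezable c x}
  ... | yes (a , w@(cu-a , _ , c⊆a)) = squeeze-⊆-R′ a w x (R-refl cu-a (c⊆a x cx))
  ... | no ¬sq = unsqueezable-⊆-R′ ¬sq x cx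

  R′-∩ : ∀ {c d x} → R′ 𝕏 c x ⊆ d → R′ 𝕏 (c ∩ d) x ⊆ R′ 𝕏 c x × R′ 𝕏 c x ⊆ R′ 𝕏 (c ∩ d) x
  R′-∩ {c} {d} {x} R′c⊆d with em {P = Squeezable c x}
  ... | yes (a , w@(cu-a , Ra⊆c , c⊆a)) =
    (λ y r → squeeze-⊆-R′ a w y (R′-⊆-squeeze a w∩ y r)) ,
    (λ y r → squeeze-⊆-R′ a w∩ y (R′-⊆-squeeze a w y r))
    where
    w∩ : SqueezeWitness 𝕏 ⟦ a ⟧ (c ∩ d) x
    w∩ = cu-a , (λ y r → Ra⊆c y r , R′c⊆d y (squeeze-⊆-R′ a w y r)) , (λ y (cy , _) → c⊆a y cy)
  ... | no ¬sq = R′-ext proj₁-⊆ c⊆c∩d x , R′-ext c⊆c∩d proj₁-⊆ x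
    where
    proj₁-⊆ : (c ∩ d) ⊆ c
    proj₁-⊆ _ = proj₁
    c⊆c∩d : c ⊆ (c ∩ d)
    c⊆c∩d y cy = cy , R′c⊆d y (unsqueezable-⊆-R′ ¬sq y cy)

  open KripkeSemantics _≤_ (R′ 𝕏)

  sound : ∀ {φ} → iCC-MP φ → ValidK (κs 𝕏) φ
  sound ipc1 V V-up x y _ py z y≤z _ = V-up 0 y z y≤z py
  sound ipc2 V V-up x y _ f z y≤z g w z≤w pw = f w (≤-trans y≤z z≤w) pw w ≤-refl (g w z≤w pw)
  sound ipc3 V V-up x y _ (py , _) = py
  sound ipc4 V V-up x y _ (_ , qy) = qy
  sound ipc5 V V-up x y _ py z y≤z qz = V-up 0 y z y≤z py , qz
  sound ipc6 V V-up x y _ py = inj₁ py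
  sound ipc7 V V-up x y _ qy = inj₂ qy
  sound ipc8 V V-up x y _ f z y≤z g w z≤w (inj₁ pw) = f w (≤-trans y≤z z≤w) pw
  sound ipc8 V V-up x y _ f z y≤z g w z≤w (inj₂ qw) = g w z≤w qw
  sound ipc9 V V-up x y _ ()
  sound ck-and V V-up x =
    (λ y _ f → (λ z r → proj₁ (f z r)) , (λ z r → proj₂ (f z r))) ,
    (λ y _ (f , g) z r → f z r , g z r)
  sound ck-top V V-up x = (λ y _ _ z _ b → b) , (λ y _ _ z _ w _ b → b)
  sound cc-id V V-up x = R′-⊆ (V 0) x
  sound cc-cut V V-up x y _ (Rp⊆q , Rpq⊆r) z r = Rpq⊆r z (proj₂ (R′-∩ Rp⊆q) z r)
  sound cc-cm V V-up x y _ (Rp⊆q , Rp⊆r) z r = Rp⊆r z (proj₁ (R′-∩ Rp⊆q) z r)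
  sound cc-mp V V-up x y _ (py , Rp⊆q) = Rp⊆q y (R′-refl py)
  sound (usub {φ} σ ⊢φ) V V-up x =
    sat-[]⁺ R′-ext V σ φ x (sound ⊢φ _ (λ n → sat-upset ≤-trans R′-antitone V V-up (σ n)) x)
  sound (mp ⊢φ⇒ψ ⊢φ) V V-up x = sound ⊢φ⇒ψ V V-up x x ≤-refl (sound ⊢φ V V-up x)
  sound (rcea {φ} {ψ} ⊢φ⇔ψ) V V-up x =
    (λ y _ f z r → f z (R′-ext ψ⊆φ φ⊆ψ y z r)) , (λ y _ f z r → f z (R′-ext φ⊆ψ ψ⊆φ y z r))
    where
    φ⊆ψ : sat _≤_ (R′ 𝕏) V φ ⊆ sat _≤_ (R′ 𝕏) V ψ
    φ⊆ψ v = proj₁ (sound ⊢φ⇔ψ V V-up v) v ≤-refl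
    ψ⊆φ : sat _≤_ (R′ 𝕏) V ψ ⊆ sat _≤_ (R′ 𝕏) V φ
    ψ⊆φ v = proj₂ (sound ⊢φ⇔ψ V V-up v) v ≤-refl
  sound (rcec ⊢φ⇔ψ) V V-up x =
    (λ y _ f z r → proj₁ (sound ⊢φ⇔ψ V V-up z) z ≤-refl (f z r)) ,
    (λ y _ f z r → proj₂ (sound ⊢φ⇔ψ V V-up z) z ≤-refl (f z r))

lemma6p8 : (∀ {ℓ} → ExcludedMiddle ℓ) →
    (𝕏 : CondEsakiaSpace) →
    (∀ φ → iCC-MP φ → ValidE 𝕏 φ) →
    ∀ φ → iCC-MP φ → ValidK (κs 𝕏) φ
lemma6p8 em 𝕏 valid _ = SqueezeFillIn.sound em 𝕏 valid
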